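{- For every $n\in\mathbb{N}$, \[ \sum_{\substack{a=1\\ (a,n)=1}}^{n}\omega\big((a-1,n)\big)=\varphi(n)\sum_{p\mid n}\frac{1}{p-1}, \] the sum on the right being over the prime divisors $p$ of $n$.
   Context: $(x,y)$ denotes the greatest common divisor (with $(0,n)=n$). $\omega(m)$ is the number of distinct prime factors of $m$ and $\varphi$ is Euler's totient function. -}

module Defs where

open import Data.Nat using (ℕ; zero; suc; _∸_; _≟_)
open import Data.Nat.GCD using (gcd)
open import Data.Nat.Divisibility using (_∣?_)
open import Data.Nat.Primality using (prime?)
open import Data.List using (List; applyUpTo; filter; length; map; foldr)
open import Data.Integer using (+_)
open import Data.Rational using (ℚ; _/_; _+_; _*_; 0ℚ)
open import Relation.Nullary.Decidable using (_×-dec_)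

range1 : ℕ → List ℕ
range1 n = applyUpTo suc n

sumℕ : List ℕ → ℕ
sumℕ = foldr Data.Nat._+_ 0

sumℚ : List ℚ → ℚ
sumℚ = foldr _+_ 0ℚ

-- the prime divisors of m (for m ≥ 1 they all lie in [1..m])
primeDivisors : ℕ → List ℕ
primeDivisors m = filter (λ p → prime? p ×-dec (p ∣? m)) (range1 m)

ω : ℕ → ℕ
ω m = length (primeDivisors m)

φ : ℕ → ℕ
φ n = length (filter (λ a → gcd a n ≟ 1) (range1 n))

-- 1/(p-1) as a rational, for p ≥ 2 (value 0 for p < 2, never used on primes)
invPred : ℕ → ℚ
invPred zero = 0ℚ
invPred (suc zero) = 0ℚ
invPred (suc (suc k)) = + 1 / suc k

ℕ→ℚ : ℕ → ℚ
ℕ→ℚ k = + k / 1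

-- left side: Σ_{1 ≤ a ≤ n, (a,n)=1} ω((a-1, n))   (gcd 0 n = n in stdlib)
lhs : ℕ → ℕ
lhs n = sumℕ (map (λ a → ω (gcd (a ∸ 1) n)) (filter (λ a → gcd a n ≟ 1) (range1 n)))

rhs : ℕ → ℚ
rhs n = ℕ→ℚ (φ n) * sumℚ (map invPred (primeDivisors n))

-- Counting the pairs (p, a) with p a prime divisor of n, a a unit modulo n and p ∣ a - 1
-- in two ways turns the left side into the sum over p ∣ n of the number N_p of units
-- a ≡ 1 (mod p). The units are equidistributed over the p - 1 nonzero residues modulo p,
-- so (p - 1) N_p = φ(n). For equidistribution write n = p^(e+1) m with p ∤ m and a residue
-- as j p + i with j < p^e m: for i ≢ 0 (mod p) it is a unit iff j p + i is coprime to m,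
-- and since p is invertible modulo m, j ↦ (j p + i) mod m permutes every block of m
-- consecutive j, so each such class contains exactly p^e φ(m) units.
module Submission where

open import Algebra.Properties.CommutativeSemigroup using (interchange; x∙yz≈y∙xz)
open import Data.Bool using (true; false; if_then_else_)
open import Data.Fin using (Fin; toℕ; fromℕ<; punchOut)
  renaming (_≟_ to _≟ᶠ_)
import Data.Fin.Properties as Finₚ
import Data.Integer as ℤ
import Data.Integer.Properties as ℤₚ
import Data.Integer.Tactic.RingSolver as ℤ-Solver
open import Data.List using ([]; _∷_; applyUpTo; filter; map; length)
open import Data.List.Relation.Unary.All as All using (All; []; _∷_)
open import Data.List.Relation.Unary.All.Properties using (all-filter)
open import Data.Nat
open import Data.Nat.Properties
open import Data.Nat.DivMod
open import Data.Nat.Divisibility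
open import Data.Nat.GCD using (gcd; gcd[m,n]∣m; gcd[m,n]∣n; gcd-greatest; gcd[m,n]≤n; gcd[m,n]≢0)
open import Data.Nat.Coprimality using (Coprime; coprime⇒gcd≡1; gcd≡1⇒coprime; coprime-divisor)
open import Data.Nat.Induction using (<-wellFounded)
open import Data.Nat.Primality
  using (Prime; prime?; prime⇒irreducible; prime⇒nonTrivial; prime⇒nonZero; ¬prime[1])
open import Data.Nat.Tactic.RingSolver using (solve-∀)
open import Data.Product using (∃₂; ∃-syntax; _×_; _,_)
open import Data.Rational as ℚ using (ℚ; fromℚᵘ; toℚᵘ)
import Data.Rational.Properties as ℚₚ
open import Data.Rational.Unnormalised as ℚᵘ using (ℚᵘ; mkℚᵘ; *≡*)
import Data.Rational.Unnormalised.Properties as ℚᵘₚ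
open import Data.Sum using (inj₁; inj₂)
open import Function using (_∘_)
open import Function.Definitions using (Injective)
open import Induction.WellFounded using (Acc; acc)
open import Relation.Nullary using (¬_; Dec; yes; no; does; contradiction)
open import Relation.Nullary.Decidable using (_×-dec_)
open import Relation.Unary using (Decidable)
open import Relation.Binary.PropositionalEquality
open ≡-Reasoning

open import Defs

𝟙 : ∀ {ℓ} {P : Set ℓ} → Dec P → ℕ
𝟙 d = if does d then 1 else 0

module _ {a} {A : Set a} where

  𝟙-yes : (d : Dec A) → A → 𝟙 d ≡ 1
  𝟙-yes (yes _) _ = refl
  𝟙-yes (no ¬a) a = contradiction a ¬a

  𝟙-no : (d : Dec A) → ¬ A → 𝟙 d ≡ 0
  𝟙-no (yes a) ¬a = contradiction a ¬a
  𝟙-no (no _)  _  = refl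

module _ {a b} {A : Set a} {B : Set b} where

  𝟙-cong : (d₁ : Dec A) (d₂ : Dec B) → (A → B) → (B → A) → 𝟙 d₁ ≡ 𝟙 d₂
  𝟙-cong d₁ (yes b) _ from = 𝟙-yes d₁ (from b)
  𝟙-cong d₁ (no ¬b) to _   = 𝟙-no d₁ (¬b ∘ to)

  𝟙-× : (d₁ : Dec A) (d₂ : Dec B) → 𝟙 (d₁ ×-dec d₂) ≡ 𝟙 d₁ * 𝟙 d₂
  𝟙-× (yes _) (yes _) = refl
  𝟙-× (yes _) (no _)  = refl
  𝟙-× (no _)  _       = refl

∑ : ℕ → (ℕ → ℕ) → ℕ
∑ zero    f = 0
∑ (suc n) f = f 0 + ∑ n (λ a → f (suc a))

syntax ∑ n (λ a → f) = ∑[ a < n ] f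

∑-cong : ∀ n {f g : ℕ → ℕ} → (∀ a → a < n → f a ≡ g a) → ∑ n f ≡ ∑ n g
∑-cong zero    _   = refl
∑-cong (suc n) f≡g = cong₂ _+_ (f≡g 0 z<s) (∑-cong n λ a a<n → f≡g (suc a) (s<s a<n))

∑-const : ∀ n c → ∑[ _ < n ] c ≡ n * c
∑-const zero    c = refl
∑-const (suc n) c = cong (c +_) (∑-const n c)

∑-zero : ∀ n {f : ℕ → ℕ} → (∀ a → a < n → f a ≡ 0) → ∑ n f ≡ 0
∑-zero n f≡0 = trans (∑-cong n f≡0) (trans (∑-const n 0) (*-zeroʳ n))

∑-distrib-+ : ∀ n (f g : ℕ → ℕ) → ∑[ a < n ] (f a + g a) ≡ ∑ n f + ∑ n g
∑-distrib-+ zero    f g = refl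
∑-distrib-+ (suc n) f g =
  trans (cong (f 0 + g 0 +_) (∑-distrib-+ n _ _)) (interchange +-commutativeSemigroup (f 0) (g 0) _ _)

∑-*ˡ : ∀ n c (f : ℕ → ℕ) → ∑[ a < n ] (c * f a) ≡ c * ∑ n f
∑-*ˡ zero    c f = sym (*-zeroʳ c)
∑-*ˡ (suc n) c f = trans (cong (c * f 0 +_) (∑-*ˡ n c _)) (sym (*-distribˡ-+ c (f 0) _))

∑-++ : ∀ m t (f : ℕ → ℕ) → ∑ (m + t) f ≡ ∑ m f + ∑[ j < t ] f (m + j)
∑-++ zero    t f = refl
∑-++ (suc m) t f = trans (cong (f 0 +_) (∑-++ m t _)) (sym (+-assoc (f 0) _ _))

∑-last : ∀ n (f : ℕ → ℕ) → ∑ (suc n) f ≡ ∑ n f + f n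
∑-last zero    f = +-identityʳ (f 0)
∑-last (suc n) f = trans (cong (f 0 +_) (∑-last n _)) (sym (+-assoc (f 0) _ _))

∑-rotate : ∀ n (f : ℕ → ℕ) → f 0 ≡ f n → ∑[ a < n ] f (suc a) ≡ ∑ n f
∑-rotate n f f0≡fn = +-cancelˡ-≡ (f 0) _ _ (begin
  f 0 + ∑[ a < n ] f (suc a) ≡⟨ ∑-last n f ⟩
  ∑ n f + f n                ≡⟨ cong (∑ n f +_) (sym f0≡fn) ⟩
  ∑ n f + f 0                ≡⟨ +-comm (∑ n f) (f 0) ⟩
  f 0 + ∑ n f                ∎)

∑-extend : ∀ {d N} (f : ℕ → ℕ) → d ≤ N → (∀ a → d ≤ a → f a ≡ 0) → ∑ N f ≡ ∑ d f
∑-extend {d} {N} f d≤N vanish = begin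
  ∑ N f                            ≡⟨ cong (λ k → ∑ k f) (sym (m+[n∸m]≡n d≤N)) ⟩
  ∑ (d + (N ∸ d)) f                ≡⟨ ∑-++ d (N ∸ d) f ⟩
  ∑ d f + ∑[ j < N ∸ d ] f (d + j) ≡⟨ cong (∑ d f +_) (∑-zero (N ∸ d) λ j _ → vanish (d + j) (m≤m+n d j)) ⟩
  ∑ d f + 0                        ≡⟨ +-identityʳ _ ⟩
  ∑ d f                            ∎

∑-comm : ∀ m n (f : ℕ → ℕ → ℕ) → ∑[ a < m ] ∑[ b < n ] f a b ≡ ∑[ b < n ] ∑[ a < m ] f a b
∑-comm zero    n f = sym (∑-zero n λ _ _ → refl)
∑-comm (suc m) n f =
  trans (cong ((∑[ b < n ] f 0 b) +_) (∑-comm m n _)) (sym (∑-distrib-+ n _ _))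

∑-blocks : ∀ k m (f : ℕ → ℕ) → ∑ (k * m) f ≡ ∑[ j < k ] ∑[ r < m ] f (j * m + r)
∑-blocks zero    m f = refl
∑-blocks (suc k) m f = begin
  ∑ (m + k * m) f                                      ≡⟨ ∑-++ m (k * m) f ⟩
  ∑ m f + ∑[ x < k * m ] f (m + x)                     ≡⟨ cong (∑ m f +_) (∑-blocks k m _) ⟩
  ∑ m f + ∑[ j < k ] ∑[ r < m ] f (m + (j * m + r))    ≡⟨ cong (∑ m f +_) (∑-cong k λ j _ → ∑-cong m λ r _ →
                                                            cong f (sym (+-assoc m (j * m) r))) ⟩
  ∑ m f + ∑[ j < k ] ∑[ r < m ] f (suc j * m + r)      ∎

∑-periodic : ∀ k m (f : ℕ → ℕ) → (∀ j r → f (j * m + r) ≡ f r) → ∑ (k * m) f ≡ k * ∑ m f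
∑-periodic k m f periodic = begin
  ∑ (k * m) f                         ≡⟨ ∑-blocks k m f ⟩
  ∑[ j < k ] ∑[ r < m ] f (j * m + r) ≡⟨ ∑-cong k (λ j _ → ∑-cong m λ r _ → periodic j r) ⟩
  ∑[ _ < k ] ∑ m f                    ≡⟨ ∑-const k _ ⟩
  k * ∑ m f                           ∎

∑-single : ∀ n (f : ℕ → ℕ) {j₀} → j₀ < n → (∀ j → j < n → j ≢ j₀ → f j ≡ 0) → ∑ n f ≡ f j₀
∑-single (suc n) f {zero} _ rest =
  trans (cong (f 0 +_) (∑-zero n λ a a<n → rest (suc a) (s<s a<n) λ ())) (+-identityʳ (f 0))
∑-single (suc n) f {suc j₀} (s<s j₀<n) rest =
  cong₂ _+_ (rest 0 z<s λ ()) (∑-single n _ j₀<n λ j j<n j≢j₀ → rest (suc j) (s<s j<n) (j≢j₀ ∘ suc-injective))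

∑-zero-then-const : ∀ p (g : ℕ → ℕ) {c} → g 0 ≡ 0 → (∀ i → 0 < i → i < p → g i ≡ c) → ∑ p g ≡ pred p * c
∑-zero-then-const zero    g _  _      = refl
∑-zero-then-const (suc q) g g0 const =
  cong₂ _+_ g0 (trans (∑-cong q λ i i<q → const (suc i) z<s (s<s i<q)) (∑-const q _))

InjectiveOn< : ℕ → (ℕ → ℕ) → Set
InjectiveOn< m h = ∀ {j k} → j < m → k < m → h j ≡ h k → j ≡ k

restrict< : ∀ {m} (h : ℕ → ℕ) → (∀ j → j < m → h j < m) → Fin m → Fin m
restrict< h h< j = fromℕ< (h< (toℕ j) (Finₚ.toℕ<n j))

toℕ-restrict< : ∀ {m} h (h< : ∀ j → j < m → h j < m) j → toℕ (restrict< h h< j) ≡ h (toℕ j)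
toℕ-restrict< h h< j = Finₚ.toℕ-fromℕ< _

-- A missed value r could be punched out, giving an injection Fin (suc m) → Fin m.
injective⇒surjective< : ∀ {m} {h : ℕ → ℕ} (h< : ∀ j → j < m → h j < m) → InjectiveOn< m h →
                        ∀ {r} → r < m → ∃[ j ] j < m × h j ≡ r
injective⇒surjective< {suc m} {h} h< h-inj {r} r<m
  with Finₚ.any? (λ j → restrict< h h< j ≟ᶠ fromℕ< r<m)
... | yes (j , hj≡r) =
  toℕ j , Finₚ.toℕ<n j , trans (sym (toℕ-restrict< h h< j)) (trans (cong toℕ hj≡r) (Finₚ.toℕ-fromℕ< r<m))
... | no r∉image = contradiction (Finₚ.injective⇒≤ punchOut-injective) 1+n≰n
  where
  missed : ∀ j → fromℕ< r<m ≢ restrict< h h< j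
  missed j r≡hj = r∉image (j , sym r≡hj)
  restrict-injective : Injective _≡_ _≡_ (restrict< h h<)
  restrict-injective {j} {k} eq = Finₚ.toℕ-injective (h-inj (Finₚ.toℕ<n j) (Finₚ.toℕ<n k)
    (trans (sym (toℕ-restrict< h h< j)) (trans (cong toℕ eq) (toℕ-restrict< h h< k))))
  punchOut-injective : Injective _≡_ _≡_ (λ j → punchOut (missed j))
  punchOut-injective {j} {k} eq = restrict-injective (Finₚ.punchOut-injective (missed j) (missed k) eq)

-- Double counting the incidences h j = r; injectivity makes h onto by the pigeonhole principle.
∑-reindex : ∀ m {h : ℕ → ℕ} → (∀ j → j < m → h j < m) → InjectiveOn< m h →
            ∀ (g : ℕ → ℕ) → ∑[ j < m ] g (h j) ≡ ∑ m g
∑-reindex m {h} h< h-inj g = begin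
  ∑[ j < m ] g (h j)           ≡⟨ ∑-cong m (λ j j<m → sym (row j j<m)) ⟩
  ∑[ j < m ] ∑[ r < m ] δ j r  ≡⟨ ∑-comm m m δ ⟩
  ∑[ r < m ] ∑[ j < m ] δ j r  ≡⟨ ∑-cong m column ⟩
  ∑ m g                        ∎
  where
  δ : ℕ → ℕ → ℕ
  δ j r = 𝟙 (h j ≟ r) * g r
  δ-on : ∀ {j r} → h j ≡ r → δ j r ≡ g r
  δ-on {j} {r} hj≡r = trans (cong (_* g r) (𝟙-yes (h j ≟ r) hj≡r)) (*-identityˡ (g r))
  δ-off : ∀ {j r} → h j ≢ r → δ j r ≡ 0
  δ-off {j} {r} hj≢r = cong (_* g r) (𝟙-no (h j ≟ r) hj≢r)
  row : ∀ j → j < m → ∑[ r < m ] δ j r ≡ g (h j)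
  row j j<m = trans (∑-single m (δ j) (h< j j<m) λ r _ r≢hj → δ-off (r≢hj ∘ sym)) (δ-on refl)
  column : ∀ r → r < m → ∑[ j < m ] δ j r ≡ g r
  column r r<m =
    let (j₀ , j₀<m , hj₀≡r) = injective⇒surjective< h< h-inj r<m
        off : ∀ j → j < m → j ≢ j₀ → δ j r ≡ 0
        off j j<m j≢j₀ = δ-off λ hj≡r → j≢j₀ (h-inj j<m j₀<m (trans hj≡r (sym hj₀≡r)))
    in trans (∑-single m (λ j → δ j r) j₀<m off) (δ-on hj₀≡r)

module _ {P : ℕ → Set} (P? : Decidable P) where

  length-filter-applyUpTo : ∀ f n → length (filter P? (applyUpTo f n)) ≡ ∑[ a < n ] 𝟙 (P? (f a))
  length-filter-applyUpTo f zero = refl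
  length-filter-applyUpTo f (suc n) with does (P? (f 0))
  ... | true  = cong suc (length-filter-applyUpTo (f ∘ suc) n)
  ... | false = length-filter-applyUpTo (f ∘ suc) n

  sum-map-filter-applyUpTo : ∀ h f n →
    sumℕ (map h (filter P? (applyUpTo f n))) ≡ ∑[ a < n ] (𝟙 (P? (f a)) * h (f a))
  sum-map-filter-applyUpTo h f zero = refl
  sum-map-filter-applyUpTo h f (suc n) with does (P? (f 0))
  ... | true  = cong₂ _+_ (sym (+-identityʳ (h (f 0)))) (sum-map-filter-applyUpTo h (f ∘ suc) n)
  ... | false = sum-map-filter-applyUpTo h (f ∘ suc) n

coprime-*ʳ : ∀ {x a b} → Coprime x a → Coprime x b → Coprime x (a * b)
coprime-*ʳ {x} {a} x⊥a x⊥b (d∣x , d∣ab) = x⊥b (d∣x , coprime-divisor d⊥a d∣ab)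
  where
  d⊥a : Coprime _ a
  d⊥a (e∣d , e∣a) = x⊥a (∣-trans e∣d d∣x , e∣a)

coprime-^ʳ : ∀ {x p} k → Coprime x p → Coprime x (p ^ k)
coprime-^ʳ zero    _   (_ , d∣1) = ∣1⇒≡1 d∣1
coprime-^ʳ (suc k) x⊥p = coprime-*ʳ x⊥p (coprime-^ʳ k x⊥p)

prime∤⇒coprime : ∀ {p x} → Prime p → ¬ p ∣ x → Coprime x p
prime∤⇒coprime pp p∤x (d∣x , d∣p) with prime⇒irreducible pp d∣p
... | inj₁ d≡1 = d≡1
... | inj₂ refl = contradiction d∣x p∤x

∣∧<⇒≡0 : ∀ {d x} → d ∣ x → x < d → x ≡ 0
∣∧<⇒≡0 {x = zero}  _   _   = refl
∣∧<⇒≡0 {x = suc x} d∣x x<d = contradiction (∣⇒≤ d∣x) (<⇒≱ x<d)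

%≡%⇒∣∸ : ∀ x y m .{{_ : NonZero m}} → x % m ≡ y % m → m ∣ y ∸ x
%≡%⇒∣∸ x y m eq = divides (y / m ∸ x / m) (begin
  y ∸ x                                     ≡⟨ cong₂ _∸_ (m≡m%n+[m/n]*n y m) (m≡m%n+[m/n]*n x m) ⟩
  (y % m + y / m * m) ∸ (x % m + x / m * m) ≡⟨ cong (λ z → (z + y / m * m) ∸ (x % m + x / m * m)) (sym eq) ⟩
  (x % m + y / m * m) ∸ (x % m + x / m * m) ≡⟨ [m+n]∸[m+o]≡n∸o (x % m) _ _ ⟩
  y / m * m ∸ x / m * m                     ≡⟨ sym (*-distribʳ-∸ m (y / m) (x / m)) ⟩
  (y / m ∸ x / m) * m                       ∎)

*+-mod-injective-≤ : ∀ {m p} .{{_ : NonZero m}} → Coprime m p → ∀ i {j k} → j ≤ k → k < m →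
                    (j * p + i) % m ≡ (k * p + i) % m → j ≡ k
*+-mod-injective-≤ {m} {p} m⊥p i {j} {k} j≤k k<m eq =
  ≤-antisym j≤k (m∸n≡0⇒m≤n (∣∧<⇒≡0 m∣k∸j (≤-<-trans (m∸n≤m k j) k<m)))
  where
  difference : (k * p + i) ∸ (j * p + i) ≡ p * (k ∸ j)
  difference = begin
    (k * p + i) ∸ (j * p + i) ≡⟨ cong₂ _∸_ (+-comm (k * p) i) (+-comm (j * p) i) ⟩
    (i + k * p) ∸ (i + j * p) ≡⟨ [m+n]∸[m+o]≡n∸o i _ _ ⟩
    k * p ∸ j * p             ≡⟨ sym (*-distribʳ-∸ p k j) ⟩
    (k ∸ j) * p               ≡⟨ *-comm (k ∸ j) p ⟩
    p * (k ∸ j)               ∎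
  m∣k∸j : m ∣ k ∸ j
  m∣k∸j = coprime-divisor m⊥p (subst (m ∣_) difference (%≡%⇒∣∸ _ _ m eq))

*+-mod-injective : ∀ {m p} .{{_ : NonZero m}} → Coprime m p → ∀ i → InjectiveOn< m (λ j → (j * p + i) % m)
*+-mod-injective m⊥p i {j} {k} j<m k<m eq with ≤-total j k
... | inj₁ j≤k = *+-mod-injective-≤ m⊥p i j≤k k<m eq
... | inj₂ k≤j = sym (*+-mod-injective-≤ m⊥p i k≤j j<m (sym eq))

coprime𝟙 : ℕ → ℕ → ℕ
coprime𝟙 x n = 𝟙 (gcd x n ≟ 1)

coprime𝟙-cong : ∀ {x y m n} → (Coprime x m → Coprime y n) → (Coprime y n → Coprime x m) →
                coprime𝟙 x m ≡ coprime𝟙 y n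
coprime𝟙-cong {x} {y} {m} {n} to from = 𝟙-cong (gcd x m ≟ 1) (gcd y n ≟ 1)
  (coprime⇒gcd≡1 ∘ to ∘ gcd≡1⇒coprime) (coprime⇒gcd≡1 ∘ from ∘ gcd≡1⇒coprime)

coprime𝟙-% : ∀ x m .{{_ : NonZero m}} → coprime𝟙 (x % m) m ≡ coprime𝟙 x m
coprime𝟙-% x m = coprime𝟙-cong
  (λ x%m⊥m (d∣x , d∣m) → x%m⊥m (%-presˡ-∣ d∣x d∣m , d∣m))
  (λ x⊥m (d∣x%m , d∣m) → x⊥m (∣n∣m%n⇒∣m d∣m d∣x%m , d∣m))

coprime𝟙-p^k* : ∀ {p x} k m → Prime p → ¬ p ∣ x → coprime𝟙 x (p ^ k * m) ≡ coprime𝟙 x m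
coprime𝟙-p^k* {p} k m pp p∤x = coprime𝟙-cong
  (λ x⊥n (d∣x , d∣m) → x⊥n (d∣x , ∣n⇒∣m*n (p ^ k) d∣m))
  (coprime-*ʳ (coprime-^ʳ k (prime∤⇒coprime pp p∤x)))

coprime𝟙-common-prime : ∀ {p x n} → Prime p → p ∣ x → p ∣ n → coprime𝟙 x n ≡ 0
coprime𝟙-common-prime {x = x} {n} pp p∣x p∣n =
  𝟙-no (gcd x n ≟ 1) λ gcd≡1 → ¬prime[1] (subst Prime (gcd≡1⇒coprime gcd≡1 (p∣x , p∣n)) pp)

p-part : ∀ {p} → Prime p → ∀ n .{{_ : NonZero n}} → ∃₂ λ k m → n ≡ p ^ k * m × ¬ p ∣ m
p-part {p} pp n = go n (<-wellFounded n)
  where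
  instance
    _ = prime⇒nonTrivial pp
  go : ∀ n .{{_ : NonZero n}} → Acc _<_ n → ∃₂ λ k m → n ≡ p ^ k * m × ¬ p ∣ m
  go n (acc smaller) with p ∣? n
  ... | no p∤n = 0 , n , sym (*-identityˡ n) , p∤n
  ... | yes p∣n with go (quotient p∣n) {{quotient≢0 p∣n}} (smaller (quotient-< p∣n))
  ...   | k , m , q≡p^k*m , p∤m = suc k , m , n≡p*p^k*m , p∤m
    where
    n≡p*p^k*m : n ≡ p * p ^ k * m
    n≡p*p^k*m = begin
      n                ≡⟨ _∣_.equality p∣n ⟩
      quotient p∣n * p ≡⟨ cong (_* p) q≡p^k*m ⟩
      p ^ k * m * p    ≡⟨ *-comm (p ^ k * m) p ⟩
      p * (p ^ k * m)  ≡⟨ sym (*-assoc p (p ^ k) m) ⟩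
      p * p ^ k * m    ∎

-- Indexed like lhs by a = u - 1: counts the units 1 ≤ u ≤ n with p ∣ u - 1.
unitsCongruentToOne : ℕ → ℕ → ℕ
unitsCongruentToOne n p = ∑[ a < n ] (coprime𝟙 (suc a) n * 𝟙 (p ∣? a))

module ResidueClasses {p} (pp : Prime p) (e m : ℕ) (p∤m : ¬ p ∣ m) where

  instance
    p-nonTrivial : NonTrivial p
    p-nonTrivial = prime⇒nonTrivial pp
    p-nonZero : NonZero p
    p-nonZero = prime⇒nonZero pp
    m-nonZero : NonZero m
    m-nonZero = ≢-nonZero λ { refl → p∤m (p ∣0) }

  n M C : ℕ
  n = p ^ suc e * m
  M = p ^ e * m
  C = p ^ e * ∑[ r < m ] coprime𝟙 r m

  p∣n : p ∣ n
  p∣n = ∣m⇒∣m*n m (m∣m*n (p ^ e))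

  p∤jp+i : ∀ j {i} → 0 < i → i < p → ¬ p ∣ j * p + i
  p∤jp+i j 0<i i<p p∣jp+i = <⇒≱ i<p (∣⇒≤ {{>-nonZero 0<i}} (∣m+n∣m⇒∣n p∣jp+i (n∣m*n j)))

  ∑-by-residue : ∀ (f : ℕ → ℕ) → ∑ n f ≡ ∑[ i < p ] ∑[ j < M ] f (j * p + i)
  ∑-by-residue f = begin
    ∑ n f                               ≡⟨ cong (λ k → ∑ k f) (n≡M*p p (p ^ e) m) ⟩
    ∑ (M * p) f                         ≡⟨ ∑-blocks M p f ⟩
    ∑[ j < M ] ∑[ i < p ] f (j * p + i) ≡⟨ ∑-comm M p _ ⟩
    ∑[ i < p ] ∑[ j < M ] f (j * p + i) ∎
    where
    n≡M*p : ∀ p q m → p * q * m ≡ q * m * p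
    n≡M*p = solve-∀

  residue-class : ∀ i → 0 < i → i < p → ∑[ j < M ] coprime𝟙 (j * p + i) n ≡ C
  residue-class i 0<i i<p = begin
    ∑[ j < M ] coprime𝟙 (j * p + i) n
      ≡⟨ ∑-cong M (λ j _ → reduce j) ⟩
    ∑[ j < p ^ e * m ] coprime𝟙 ((j * p + i) % m) m
      ≡⟨ ∑-periodic (p ^ e) m _ (λ j r → cong (λ x → coprime𝟙 x m) (period j r)) ⟩
    p ^ e * ∑[ j < m ] coprime𝟙 ((j * p + i) % m) m
      ≡⟨ cong (p ^ e *_) (∑-reindex m (λ j _ → m%n<n _ m) (*+-mod-injective m⊥p i) (λ r → coprime𝟙 r m)) ⟩
    C ∎
    where
    m⊥p : Coprime m p
    m⊥p = prime∤⇒coprime pp p∤m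
    reduce : ∀ j → coprime𝟙 (j * p + i) n ≡ coprime𝟙 ((j * p + i) % m) m
    reduce j = trans (coprime𝟙-p^k* (suc e) m pp (p∤jp+i j 0<i i<p)) (sym (coprime𝟙-% _ m))
    shift : ∀ j m r p i → (j * m + r) * p + i ≡ r * p + i + j * p * m
    shift = solve-∀
    period : ∀ j r → ((j * m + r) * p + i) % m ≡ (r * p + i) % m
    period j r = trans (cong (_% m) (shift j m r p i)) ([m+kn]%n≡m%n (r * p + i) (j * p) m)

  residue-class-zero : ∑[ j < M ] coprime𝟙 (j * p + 0) n ≡ 0
  residue-class-zero = ∑-zero M λ j _ →
    coprime𝟙-common-prime pp (subst (p ∣_) (sym (+-identityʳ _)) (n∣m*n j)) p∣n

  units≡pred*C : ∑[ b < n ] coprime𝟙 b n ≡ pred p * C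
  units≡pred*C = trans (∑-by-residue _) (∑-zero-then-const p _ residue-class-zero residue-class)

  unitsCongruentToOne≡C : unitsCongruentToOne n p ≡ C
  unitsCongruentToOne≡C = begin
    unitsCongruentToOne n p
      ≡⟨ ∑-by-residue _ ⟩
    ∑[ i < p ] ∑[ j < M ] (coprime𝟙 (suc (j * p + i)) n * 𝟙 (p ∣? j * p + i))
      ≡⟨ ∑-single p _ (>-nonZero⁻¹ p) off ⟩
    ∑[ j < M ] (coprime𝟙 (suc (j * p + 0)) n * 𝟙 (p ∣? j * p + 0))
      ≡⟨ ∑-cong M (λ j _ → on j) ⟩
    ∑[ j < M ] coprime𝟙 (j * p + 1) n
      ≡⟨ residue-class 1 z<s (nonTrivial⇒n>1 p) ⟩
    C ∎
    where
    on : ∀ j → coprime𝟙 (suc (j * p + 0)) n * 𝟙 (p ∣? j * p + 0) ≡ coprime𝟙 (j * p + 1) n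
    on j = begin
      coprime𝟙 (suc (j * p + 0)) n * 𝟙 (p ∣? j * p + 0)
        ≡⟨ cong₂ (λ x y → coprime𝟙 x n * y) (sym (+-suc (j * p) 0))
                 (𝟙-yes (p ∣? j * p + 0) (subst (p ∣_) (sym (+-identityʳ _)) (n∣m*n j))) ⟩
      coprime𝟙 (j * p + 1) n * 1
        ≡⟨ *-identityʳ _ ⟩
      coprime𝟙 (j * p + 1) n ∎
    off : ∀ i → i < p → i ≢ 0 → ∑[ j < M ] (coprime𝟙 (suc (j * p + i)) n * 𝟙 (p ∣? j * p + i)) ≡ 0
    off i i<p i≢0 = ∑-zero M λ j _ →
      trans (cong (coprime𝟙 (suc (j * p + i)) n *_) (𝟙-no (p ∣? j * p + i) (p∤jp+i j (n≢0⇒n>0 i≢0) i<p)))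
            (*-zeroʳ (coprime𝟙 (suc (j * p + i)) n))

  pred*unitsCongruentToOne≡units : pred p * unitsCongruentToOne n p ≡ ∑[ b < n ] coprime𝟙 b n
  pred*unitsCongruentToOne≡units = trans (cong (pred p *_) unitsCongruentToOne≡C) (sym units≡pred*C)

φ≡∑coprime𝟙 : ∀ n .{{_ : NonZero n}} → φ n ≡ ∑[ b < n ] coprime𝟙 b n
φ≡∑coprime𝟙 n = trans (length-filter-applyUpTo (λ a → gcd a n ≟ 1) suc n)
  (∑-rotate n (λ b → coprime𝟙 b n) (trans (cong (λ x → coprime𝟙 x n) (sym (n%n≡0 n))) (coprime𝟙-% n n)))

pred*unitsCongruentToOne≡φ : ∀ n .{{_ : NonZero n}} {p} → Prime p → p ∣ n → pred p * unitsCongruentToOne n p ≡ φ n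
pred*unitsCongruentToOne≡φ n {p} pp p∣n with p-part pp n
... | zero , m , n≡m , p∤m = contradiction (subst (p ∣_) (trans n≡m (*-identityˡ m)) p∣n) p∤m
... | suc e , m , n≡p^e*m , p∤m = trans
  (subst (λ z → pred p * unitsCongruentToOne z p ≡ ∑[ b < z ] coprime𝟙 b z) (sym n≡p^e*m)
         (ResidueClasses.pred*unitsCongruentToOne≡units pp e m p∤m))
  (sym (φ≡∑coprime𝟙 n))

primeDivisor? : ∀ d q → Dec (Prime q × q ∣ d)
primeDivisor? d q = prime? q ×-dec (q ∣? d)

ω≡∑ : ∀ d N .{{_ : NonZero d}} → d ≤ N → ω d ≡ ∑[ q < N ] 𝟙 (primeDivisor? d (suc q))
ω≡∑ d N d≤N = begin
  ω d                                   ≡⟨ length-filter-applyUpTo (primeDivisor? d) suc d ⟩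
  ∑[ q < d ] 𝟙 (primeDivisor? d (suc q)) ≡⟨ ∑-extend _ d≤N beyond ⟨
  ∑[ q < N ] 𝟙 (primeDivisor? d (suc q)) ∎
  where
  beyond : ∀ q → d ≤ q → 𝟙 (primeDivisor? d (suc q)) ≡ 0
  beyond q d≤q = 𝟙-no (primeDivisor? d (suc q)) λ (_ , 1+q∣d) → <⇒≱ (s≤s d≤q) (∣⇒≤ 1+q∣d)

ω-gcd : ∀ a n .{{_ : NonZero n}} →
        ω (gcd a n) ≡ ∑[ q < n ] (𝟙 (primeDivisor? n (suc q)) * 𝟙 (suc q ∣? a))
ω-gcd a n = trans (ω≡∑ (gcd a n) n (gcd[m,n]≤n a n)) (∑-cong n λ q _ →
  trans (𝟙-cong (primeDivisor? (gcd a n) (suc q)) (primeDivisor? n (suc q) ×-dec (suc q ∣? a))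
                (λ (pr , d∣g) → (pr , ∣-trans d∣g (gcd[m,n]∣n a n)) , ∣-trans d∣g (gcd[m,n]∣m a n))
                (λ ((pr , d∣n) , d∣a) → pr , gcd-greatest d∣a d∣n))
        (𝟙-× (primeDivisor? n (suc q)) (suc q ∣? a)))
  where
  instance
    _ = ≢-nonZero (gcd[m,n]≢0 a n (inj₂ (≢-nonZero⁻¹ n)))

lhs≡∑unitsCongruentToOne : ∀ n .{{_ : NonZero n}} → lhs n ≡ sumℕ (map (unitsCongruentToOne n) (primeDivisors n))
lhs≡∑unitsCongruentToOne n = begin
  lhs n
    ≡⟨ sum-map-filter-applyUpTo (λ a → gcd a n ≟ 1) (λ a → ω (gcd (a ∸ 1) n)) suc n ⟩
  ∑[ a < n ] (coprime𝟙 (suc a) n * ω (gcd a n))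
    ≡⟨ ∑-cong n (λ a _ → cong (coprime𝟙 (suc a) n *_) (ω-gcd a n)) ⟩
  ∑[ a < n ] (coprime𝟙 (suc a) n * ∑[ q < n ] (P q * D q a))
    ≡⟨ ∑-cong n (λ a _ → sym (∑-*ˡ n (coprime𝟙 (suc a) n) λ q → P q * D q a)) ⟩
  ∑[ a < n ] ∑[ q < n ] (coprime𝟙 (suc a) n * (P q * D q a))
    ≡⟨ ∑-cong n (λ a _ → ∑-cong n λ q _ → x∙yz≈y∙xz *-commutativeSemigroup (coprime𝟙 (suc a) n) (P q) (D q a)) ⟩
  ∑[ a < n ] ∑[ q < n ] (P q * (coprime𝟙 (suc a) n * D q a))
    ≡⟨ ∑-comm n n _ ⟩
  ∑[ q < n ] ∑[ a < n ] (P q * (coprime𝟙 (suc a) n * D q a))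
    ≡⟨ ∑-cong n (λ q _ → ∑-*ˡ n (P q) λ a → coprime𝟙 (suc a) n * D q a) ⟩
  ∑[ q < n ] (P q * unitsCongruentToOne n (suc q))
    ≡⟨ sum-map-filter-applyUpTo (primeDivisor? n) (unitsCongruentToOne n) suc n ⟨
  sumℕ (map (unitsCongruentToOne n) (primeDivisors n)) ∎
  where
  P : ℕ → ℕ
  P q = 𝟙 (primeDivisor? n (suc q))
  D : ℕ → ℕ → ℕ
  D q a = 𝟙 (suc q ∣? a)

fromℚᵘ-homo-+ : ∀ x y → fromℚᵘ (x ℚᵘ.+ y) ≡ fromℚᵘ x ℚ.+ fromℚᵘ y
fromℚᵘ-homo-+ x y = begin
  fromℚᵘ (x ℚᵘ.+ y)                              ≡⟨ ℚₚ.fromℚᵘ-cong (ℚᵘₚ.+-cong (ℚᵘₚ.≃-sym (ℚₚ.toℚᵘ-fromℚᵘ x))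
                                                                                (ℚᵘₚ.≃-sym (ℚₚ.toℚᵘ-fromℚᵘ y))) ⟩
  fromℚᵘ (toℚᵘ (fromℚᵘ x) ℚᵘ.+ toℚᵘ (fromℚᵘ y)) ≡⟨ ℚₚ.fromℚᵘ-cong (ℚₚ.toℚᵘ-homo-+ (fromℚᵘ x) (fromℚᵘ y)) ⟨
  fromℚᵘ (toℚᵘ (fromℚᵘ x ℚ.+ fromℚᵘ y))         ≡⟨ ℚₚ.fromℚᵘ-toℚᵘ _ ⟩
  fromℚᵘ x ℚ.+ fromℚᵘ y                          ∎

fromℚᵘ-homo-* : ∀ x y → fromℚᵘ (x ℚᵘ.* y) ≡ fromℚᵘ x ℚ.* fromℚᵘ y
fromℚᵘ-homo-* x y = begin
  fromℚᵘ (x ℚᵘ.* y)                              ≡⟨ ℚₚ.fromℚᵘ-cong (ℚᵘₚ.*-cong (ℚᵘₚ.≃-sym (ℚₚ.toℚᵘ-fromℚᵘ x))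
                                                                                (ℚᵘₚ.≃-sym (ℚₚ.toℚᵘ-fromℚᵘ y))) ⟩
  fromℚᵘ (toℚᵘ (fromℚᵘ x) ℚᵘ.* toℚᵘ (fromℚᵘ y)) ≡⟨ ℚₚ.fromℚᵘ-cong (ℚₚ.toℚᵘ-homo-* (fromℚᵘ x) (fromℚᵘ y)) ⟨
  fromℚᵘ (toℚᵘ (fromℚᵘ x ℚ.* fromℚᵘ y))         ≡⟨ ℚₚ.fromℚᵘ-toℚᵘ _ ⟩
  fromℚᵘ x ℚ.* fromℚᵘ y                          ∎

ℕ→ℚᵘ : ℕ → ℚᵘ
ℕ→ℚᵘ k = mkℚᵘ (ℤ.+ k) 0

ℕ→ℚ-homo-+ : ∀ a b → ℕ→ℚ (a + b) ≡ ℕ→ℚ a ℚ.+ ℕ→ℚ b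
ℕ→ℚ-homo-+ a b =
  trans (ℚₚ.fromℚᵘ-cong {ℕ→ℚᵘ (a + b)} {ℕ→ℚᵘ a ℚᵘ.+ ℕ→ℚᵘ b} (*≡* cross)) (fromℚᵘ-homo-+ (ℕ→ℚᵘ a) (ℕ→ℚᵘ b))
  where
  open ℤ using (1ℤ) renaming (_*_ to _*ℤ_; _+_ to _+ℤ_)
  ring : ∀ x y → (x +ℤ y) *ℤ 1ℤ ≡ (x *ℤ 1ℤ +ℤ y *ℤ 1ℤ) *ℤ 1ℤ
  ring = ℤ-Solver.solve-∀
  cross : ℤ.+ (a + b) *ℤ 1ℤ ≡ (ℤ.+ a *ℤ 1ℤ +ℤ ℤ.+ b *ℤ 1ℤ) *ℤ 1ℤ
  cross = trans (cong (_*ℤ 1ℤ) (ℤₚ.pos-+ a b)) (ring (ℤ.+ a) (ℤ.+ b))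

ℕ→ℚ-*-invPred : ∀ p .{{_ : NonTrivial p}} N → ℕ→ℚ (pred p * N) ℚ.* invPred p ≡ ℕ→ℚ N
ℕ→ℚ-*-invPred (2+ k) N =
  trans (sym (fromℚᵘ-homo-* (ℕ→ℚᵘ (suc k * N)) (mkℚᵘ 1ℤ k)))
        (ℚₚ.fromℚᵘ-cong {ℕ→ℚᵘ (suc k * N) ℚᵘ.* mkℚᵘ 1ℤ k} {ℕ→ℚᵘ N} (*≡* cross))
  where
  open ℤ using (1ℤ) renaming (_*_ to _*ℤ_)
  ring : ∀ x y → (x *ℤ y *ℤ 1ℤ) *ℤ 1ℤ ≡ y *ℤ x
  ring = ℤ-Solver.solve-∀
  cross : (ℤ.+ (suc k * N) *ℤ 1ℤ) *ℤ 1ℤ ≡ ℤ.+ N *ℤ ℤ.+ (1 * suc k)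
  cross = trans (cong (λ z → (z *ℤ 1ℤ) *ℤ 1ℤ) (ℤₚ.pos-* (suc k) N))
                (trans (ring (ℤ.+ suc k) (ℤ.+ N)) (cong (λ z → ℤ.+ N *ℤ ℤ.+ z) (sym (*-identityˡ (suc k)))))

ℕ→ℚ-sum-map : ∀ (f : ℕ → ℕ) (g : ℕ → ℚ) c {xs} → All (λ x → ℕ→ℚ (f x) ≡ c ℚ.* g x) xs →
              ℕ→ℚ (sumℕ (map f xs)) ≡ c ℚ.* sumℚ (map g xs)
ℕ→ℚ-sum-map f g c []                     = sym (ℚₚ.*-zeroʳ c)
ℕ→ℚ-sum-map f g c {x ∷ xs} (fx≡cgx ∷ rest) = begin
  ℕ→ℚ (f x + sumℕ (map f xs))                 ≡⟨ ℕ→ℚ-homo-+ (f x) _ ⟩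
  ℕ→ℚ (f x) ℚ.+ ℕ→ℚ (sumℕ (map f xs))         ≡⟨ cong₂ ℚ._+_ fx≡cgx (ℕ→ℚ-sum-map f g c rest) ⟩
  c ℚ.* g x ℚ.+ c ℚ.* sumℚ (map g xs)         ≡⟨ ℚₚ.*-distribˡ-+ c (g x) _ ⟨
  c ℚ.* (g x ℚ.+ sumℚ (map g xs))             ∎

ℕ→ℚ≡*invPred : ∀ {p N t} → Prime p → pred p * N ≡ t → ℕ→ℚ N ≡ ℕ→ℚ t ℚ.* invPred p
ℕ→ℚ≡*invPred {p} {N} {t} pp pred*N≡t = begin
  ℕ→ℚ N                             ≡⟨ ℕ→ℚ-*-invPred p {{prime⇒nonTrivial pp}} N ⟨
  ℕ→ℚ (pred p * N) ℚ.* invPred p    ≡⟨ cong (λ z → ℕ→ℚ z ℚ.* invPred p) pred*N≡t ⟩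
  ℕ→ℚ t ℚ.* invPred p               ∎

mainTheorem5 : (n : ℕ) → .{{_ : NonZero n}} → ℕ→ℚ (lhs n) ≡ rhs n
mainTheorem5 n = begin
  ℕ→ℚ (lhs n)
    ≡⟨ cong ℕ→ℚ (lhs≡∑unitsCongruentToOne n) ⟩
  ℕ→ℚ (sumℕ (map (unitsCongruentToOne n) (primeDivisors n)))
    ≡⟨ ℕ→ℚ-sum-map _ invPred (ℕ→ℚ (φ n)) (All.map term (all-filter (primeDivisor? n) (range1 n))) ⟩
  rhs n ∎
  where
  term : ∀ {p} → Prime p × p ∣ n → ℕ→ℚ (unitsCongruentToOne n p) ≡ ℕ→ℚ (φ n) ℚ.* invPred p
  term (pp , p∣n) = ℕ→ℚ≡*invPred pp (pred*unitsCongruentToOne≡φ n pp p∣n)
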